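{- Let $C_n$ be a cycle ($n\ge 3$) and let $G=Cor_t(C_n)$ be its $t$-corona, where $t\ge 1$. Then $vcfc(G)=3$.
   Context: The $t$-corona $Cor_t(H)$ of a graph $H$ is the graph obtained from $H$ by adding $t$ pendant edges (to $t$ new vertices) at each vertex of $H$. Vertex-colorings are arbitrary, not necessarily proper. A path in a vertex-colored graph is called conflict-free if there is a color used on exactly one of its vertices. A vertex-colored graph is conflict-free vertex-connected if any two vertices of the graph are connected by a conflict-free path. For a connected graph $G$, the conflict-free vertex-connection number $vcfc(G)$ is the smallest number of colors needed in a vertex-coloring of $G$ that makes $G$ conflict-free vertex-connected. -}

module Defs where

open import Level using (Level; suc; zero)
open import Data.Nat as ℕ using (ℕ; _∸_; _<_)
open import Data.Fin as Fin using (Fin; toℕ)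
open import Data.Fin.Properties using (_≟_)
open import Data.Product using (_×_; _,_; ∃; ∃-syntax)
open import Data.Sum using (_⊎_; inj₁; inj₂)
open import Data.Empty using (⊥)
open import Data.List using (List; []; _∷_; length; filter)
open import Data.List.Relation.Unary.Unique.Propositional using (Unique)
open import Relation.Binary.PropositionalEquality using (_≡_)
open import Relation.Nullary using (¬_)

record Graph : Set₁ where
  field
    V   : Set
    Adj : V → V → Set
open Graph public

CycleAdj : (n : ℕ) → Fin n → Fin n → Set
CycleAdj n i j = toℕ j ≡ ℕ.suc (toℕ i) ⊎ (toℕ i ≡ n ∸ 1 × toℕ j ≡ 0)

Cycle : ℕ → Graph
Cycle n = record { V = Fin n ; Adj = λ i j → CycleAdj n i j ⊎ CycleAdj n j i }

-- The t-corona: each vertex v of H gets t new pendant vertices (v , i), i : Fin t.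
CoronaAdj : (H : Graph) (t : ℕ) → V H ⊎ (V H × Fin t) → V H ⊎ (V H × Fin t) → Set
CoronaAdj H t (inj₁ a) (inj₁ b) = Adj H a b
CoronaAdj H t (inj₁ a) (inj₂ (b , _)) = a ≡ b
CoronaAdj H t (inj₂ (a , _)) (inj₁ b) = a ≡ b
CoronaAdj H t (inj₂ _) (inj₂ _) = ⊥

Cor : ℕ → Graph → Graph
Cor t H = record { V = V H ⊎ (V H × Fin t) ; Adj = CoronaAdj H t }

data Walk (G : Graph) : V G → V G → List (V G) → Set where
  single : ∀ u → Walk G u u (u ∷ [])
  step   : ∀ {u w v p} → Adj G u w → Walk G w v p → Walk G u v (u ∷ p)

IsPath : (G : Graph) → V G → V G → List (V G) → Set
IsPath G u v p = Walk G u v p × Unique p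

countColour : {A : Set} {k : ℕ} → (A → Fin k) → Fin k → List A → ℕ
countColour c col p = length (filter (λ x → c x ≟ col) p)

ConflictFree : {A : Set} {k : ℕ} → (A → Fin k) → List A → Set
ConflictFree {k = k} c p = ∃[ col ] countColour c col p ≡ 1

-- Conflict-free vertex-connected colouring (vertex-colourings arbitrary).
CFVConnected : (G : Graph) {k : ℕ} → (V G → Fin k) → Set
CFVConnected G c = ∀ (u v : V G) → ∃[ p ] (IsPath G u v p × ConflictFree c p)

vcfc≡ : Graph → ℕ → Set
vcfc≡ G m = (∃[ c ] CFVConnected G {m} c)
          × (∀ k → k < m → (c : V G → Fin k) → ¬ CFVConnected G c)

-- Upper bound: colour the cycle vertex 0 with 2, the other cycle vertices with 0 and all
-- pendant vertices with 1. Two vertices with different centres are joined by a path through 0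
-- (walk down to 0, jump to n-1, walk down again), on which 2 occurs once; vertices with the
-- same centre are joined by a path of at most three vertices, on which the colour of the
-- pendants or that of the centre occurs once. This works for the corona of any graph having a
-- vertex that lies on a path between any two others.
-- Lower bound: the only path from a pendant to its centre is that edge, so with fewer than
-- three colours every pendant differs in colour from its centre. With two colours, a path
-- joining pendants of two different centres then meets both colours at least twice.
module Submission where

open import Defs
open import Data.Nat using (ℕ; zero; suc; _+_; _∸_; _≤_; _<_; z≤n; s≤s)
open import Data.Nat.Properties
  using (≤-refl; ≤-trans; <-trans; n<1+n; <-irrefl; <-cmp; n≤1+n; m≤n⇒m≤1+n; m∸n+n≡m)
open import Data.Fin using (Fin; toℕ; fromℕ)
open import Data.Fin.Properties using (_≟_; toℕ-injective; toℕ<n; toℕ-fromℕ; toℕ-fromℕ<; ≤fromℕ)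
open import Data.Product using (_×_; _,_; ∃-syntax; proj₁; proj₂)
open import Data.Sum using (_⊎_; inj₁; inj₂; swap)
open import Data.Empty using (⊥-elim)
open import Data.List using (List; []; _∷_; _++_; map; reverse; length)
open import Data.List.Properties using (filter-accept; filter-reject; unfold-reverse; ++-identityʳ)
open import Data.List.Relation.Unary.All as All using (All; []; _∷_)
open import Data.List.Relation.Unary.All.Properties using (¬Any⇒All¬)
open import Data.List.Relation.Unary.Any using (here; there)
open import Data.List.Relation.Unary.Any.Properties using (reverse⁺)
open import Data.List.Relation.Unary.AllPairs using ([]; _∷_)
open import Data.List.Membership.Propositional using (_∈_; _∉_)
open import Data.List.Membership.Propositional.Properties
  using (∈-filter⁺; ∈-map⁺; ∈-map⁻; ∈-++⁺ˡ; ∈-++⁺ʳ; ∈-++⁻)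
open import Data.List.Relation.Unary.Unique.Propositional using (Unique)
import Data.List.Relation.Unary.Unique.Propositional.Properties as Unique
open import Data.List.Relation.Binary.Permutation.Setoid.Properties using (Unique-resp-↭; ↭-reverse)
open import Data.List.Relation.Binary.Permutation.Setoid using (↭-sym)
open import Data.List.Relation.Binary.Disjoint.Propositional using (Disjoint)
open import Relation.Binary using (tri<; tri≈; tri>)
open import Relation.Binary.Definitions using (DecidableEquality)
open import Relation.Binary.PropositionalEquality
open import Relation.Nullary using (¬_; yes; no)

module _ {A : Set} {k : ℕ} (c : A → Fin k) where

  countColour-accept : ∀ {col x xs} → c x ≡ col →
                       countColour c col (x ∷ xs) ≡ suc (countColour c col xs)
  countColour-accept e = cong length (filter-accept (λ z → c z ≟ _) e)

  countColour-reject : ∀ {col x xs} → c x ≢ col →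
                       countColour c col (x ∷ xs) ≡ countColour c col xs
  countColour-reject e = cong length (filter-reject (λ z → c z ≟ _) e)

  countColour-≡0 : ∀ {col xs} → All (λ y → c y ≢ col) xs → countColour c col xs ≡ 0
  countColour-≡0 []         = refl
  countColour-≡0 (cy ∷ cys) = trans (countColour-reject cy) (countColour-≡0 cys)

  countColour-≡1 : ∀ {col x xs} → Unique xs → x ∈ xs → c x ≡ col →
                   All (λ y → c y ≡ col → y ≡ x) xs → countColour c col xs ≡ 1
  countColour-≡1 (x∉ys ∷ _) (here refl) cx (_ ∷ only) =
    trans (countColour-accept cx) (cong suc (countColour-≡0 (All.zipWith others (x∉ys , only))))
    where
    others : ∀ {y} → _ ≢ y × (c y ≡ _ → y ≡ _) → c y ≢ _
    others (x≢y , only-x) cy = x≢y (sym (only-x cy))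
  countColour-≡1 (y∉ys ∷ u) (there x∈ys) cx (only-y ∷ only) =
    trans (countColour-reject (λ cy → All.lookup y∉ys (subst (_∈ _) (sym (only-y cy)) x∈ys) refl))
          (countColour-≡1 u x∈ys cx only)

  countColour-≥2 : ∀ {col x y xs} → x ∈ xs → y ∈ xs → x ≢ y → c x ≡ col → c y ≡ col →
                   2 ≤ countColour c col xs
  countColour-≥2 x∈xs y∈xs x≢y cx cy =
    distinct-members (∈-filter⁺ (λ z → c z ≟ _) x∈xs cx) (∈-filter⁺ (λ z → c z ≟ _) y∈xs cy) x≢y
    where
    distinct-members : ∀ {x y} {zs : List A} → x ∈ zs → y ∈ zs → x ≢ y → 2 ≤ length zs
    distinct-members (here refl)        (here refl)        x≢y = ⊥-elim (x≢y refl)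
    distinct-members (here _)           (there (here _))   _   = s≤s (s≤s z≤n)
    distinct-members (here _)           (there (there _))  _   = s≤s (s≤s z≤n)
    distinct-members (there (here _))   (here _)           _   = s≤s (s≤s z≤n)
    distinct-members (there (there _))  (here _)           _   = s≤s (s≤s z≤n)
    distinct-members (there x∈zs)       (there y∈zs)       x≢y =
      m≤n⇒m≤1+n (distinct-members x∈zs y∈zs x≢y)

  countColour-pair≢1 : ∀ {col x y} → c x ≡ c y → countColour c col (x ∷ y ∷ []) ≢ 1
  countColour-pair≢1 {col} {x} {y} cx≡cy with c x ≟ col
  ... | yes cx rewrite countColour-accept {xs = []} (trans (sym cx≡cy) cx) = λ ()
  ... | no ¬cx rewrite countColour-reject {xs = []} (λ cy → ¬cx (trans cx≡cy cy)) = λ ()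

  conflictFree-by : ∀ {col xs} x → Unique xs → x ∈ xs → c x ≡ col →
                    All (λ y → c y ≡ col → y ≡ x) xs → ConflictFree c xs
  conflictFree-by _ u x∈xs cx only = _ , countColour-≡1 u x∈xs cx only

module _ {G : Graph} where

  walk-head : ∀ {u v p} → Walk G u v p → u ∈ p
  walk-head (single _) = here refl
  walk-head (step _ _) = here refl

  walk-last : ∀ {u v p} → Walk G u v p → v ∈ p
  walk-last (single _)  = here refl
  walk-last (step _ wk) = there (walk-last wk)

  walk-join : ∀ {u w x v p q} → Walk G u w p → Adj G w x → Walk G x v q → Walk G u v (p ++ q)
  walk-join (single _)  wx wk₂ = step wx wk₂
  walk-join (step a wk) wx wk₂ = step a (walk-join wk wx wk₂)

  walk-map : ∀ {G′ : Graph} (f : V G → V G′) → (∀ {x y} → Adj G x y → Adj G′ (f x) (f y)) →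
             ∀ {u v p} → Walk G u v p → Walk G′ (f u) (f v) (map f p)
  walk-map f hom (single u)  = single (f u)
  walk-map f hom (step a wk) = step (hom a) (walk-map f hom wk)

  walk-reverse : (∀ {x y} → Adj G x y → Adj G y x) →
                 ∀ {u v p} → Walk G u v p → Walk G v u (reverse p)
  walk-reverse sym-adj (single u) = single u
  walk-reverse sym-adj {u} {p = u ∷ p} (step a wk) =
    subst (Walk G _ u) (sym (unfold-reverse u p)) (walk-join (walk-reverse sym-adj wk) (sym-adj a) (single u))

  isPath-join : ∀ {u w x v p q} → IsPath G u w p → Adj G w x → IsPath G x v q → Disjoint p q →
                IsPath G u v (p ++ q)
  isPath-join (wk , u) wx (wk′ , u′) p#q = walk-join wk wx wk′ , Unique.++⁺ u u′ p#q

  isPath-reverse : (∀ {x y} → Adj G x y → Adj G y x) →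
                   ∀ {u v p} → IsPath G u v p → IsPath G v u (reverse p)
  isPath-reverse sym-adj {p = p} (wk , u) =
    walk-reverse sym-adj wk , Unique-resp-↭ (setoid _) (↭-sym (setoid _) (↭-reverse (setoid _) p)) u

Cycle-sym : ∀ {n} {i j : Fin n} → Adj (Cycle n) i j → Adj (Cycle n) j i
Cycle-sym = swap

module _ {n : ℕ} where

  Between : Fin n → Fin n → Fin n → Set
  Between lo hi x = toℕ lo ≤ toℕ x × toℕ x ≤ toℕ hi

  descent-step : ∀ {i i′ j : Fin n} {p} → toℕ i ≡ suc (toℕ i′) →
                 IsPath (Cycle n) i′ j p × All (Between j i′) p →
                 IsPath (Cycle n) i j (i ∷ p) × All (Between j i) (i ∷ p)
  descent-step {i} {i′} {j} i≡1+i′ ((wk , u) , between) =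
    (step (inj₂ (inj₁ i≡1+i′)) wk , All.map i≢ between ∷ u) ,
    (j≤i , ≤-refl) ∷ All.map (λ (j≤x , x≤i′) → j≤x , ≤-trans x≤i′ i′≤i) between
    where
    i′≤i : toℕ i′ ≤ toℕ i
    i′≤i = subst (toℕ i′ ≤_) (sym i≡1+i′) (n≤1+n _)
    j≤i : toℕ j ≤ toℕ i
    j≤i = ≤-trans (All.lookup between (walk-last wk) .proj₂) i′≤i
    i≢ : ∀ {x} → Between j i′ x → i ≢ x
    i≢ (_ , x≤i′) refl = <-irrefl refl (subst (_≤ toℕ i′) i≡1+i′ x≤i′)

  cycle-descent : ∀ {i j : Fin n} → toℕ j ≤ toℕ i →
                  ∃[ p ] (IsPath (Cycle n) i j p × All (Between j i) p)
  cycle-descent {i} {j} j≤i = descent (toℕ i ∸ toℕ j) (sym (m∸n+n≡m j≤i))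
    where
    descent : ∀ d {i} → toℕ i ≡ d + toℕ j → ∃[ p ] (IsPath (Cycle n) i j p × All (Between j i) p)
    descent zero {i} i≡j with toℕ-injective i≡j
    ... | refl = i ∷ [] , (single i , [] ∷ []) , (≤-refl , ≤-refl) ∷ []
    descent (suc d) {i} i≡d+1+j =
      let p , path = descent d (toℕ-fromℕ< i′<n)
      in i ∷ p , descent-step (trans i≡d+1+j (cong suc (sym (toℕ-fromℕ< i′<n)))) path
      where
      i′<n : d + toℕ j < n
      i′<n = <-trans (n<1+n _) (subst (_< n) i≡d+1+j (toℕ<n i))

  below-disjoint-above : ∀ {lo a b hi : Fin n} {p q} → toℕ a < toℕ b →
                         All (Between lo a) p → All (Between b hi) q → Disjoint p q
  below-disjoint-above a<b below above (x∈p , x∈q) =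
    <-irrefl refl (≤-trans (s≤s (All.lookup below x∈p .proj₂))
                           (≤-trans a<b (All.lookup above x∈q .proj₁)))

module _ {m : ℕ} where

  cycle-wraparound : ∀ {a b : Fin (suc m)} → toℕ a < toℕ b →
                     ∃[ p ] (IsPath (Cycle (suc m)) a b p × Fin.zero ∈ p)
  cycle-wraparound {a} {b} a<b =
    let p , (wk , u) , down  = cycle-descent {i = a} {j = Fin.zero} z≤n
        q , path′ , down′   = cycle-descent {i = fromℕ m} {j = b} (≤fromℕ b)
        wrap : Adj (Cycle (suc m)) Fin.zero (fromℕ m)
        wrap = inj₂ (inj₂ (toℕ-fromℕ m , refl))
    in p ++ q , isPath-join (wk , u) wrap path′ (below-disjoint-above a<b down down′) ,
       ∈-++⁺ˡ (walk-last wk)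

  cycle-through-zero : ∀ (a b : Fin (suc m)) → a ≢ b →
                       ∃[ p ] (IsPath (Cycle (suc m)) a b p × Fin.zero ∈ p)
  cycle-through-zero a b a≢b with <-cmp (toℕ a) (toℕ b)
  ... | tri< a<b _ _ = cycle-wraparound a<b
  ... | tri≈ _ a≡b _ = ⊥-elim (a≢b (toℕ-injective a≡b))
  ... | tri> _ _ b<a =
    let p , path , 0∈p = cycle-wraparound b<a
    in reverse p , isPath-reverse Cycle-sym path , reverse⁺ 0∈p

Fin1-unique : (x y : Fin 1) → x ≡ y
Fin1-unique Fin.zero Fin.zero = refl

Fin2-cover : ∀ {x y : Fin 2} → x ≢ y → ∀ z → x ≡ z ⊎ y ≡ z
Fin2-cover {Fin.zero}           {Fin.zero}           x≢y _ = ⊥-elim (x≢y refl)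
Fin2-cover {Fin.zero}           {Fin.suc Fin.zero}   _ Fin.zero           = inj₁ refl
Fin2-cover {Fin.zero}           {Fin.suc Fin.zero}   _ (Fin.suc Fin.zero) = inj₂ refl
Fin2-cover {Fin.suc Fin.zero}   {Fin.zero}           _ Fin.zero           = inj₂ refl
Fin2-cover {Fin.suc Fin.zero}   {Fin.zero}           _ (Fin.suc Fin.zero) = inj₁ refl
Fin2-cover {Fin.suc Fin.zero}   {Fin.suc Fin.zero}   x≢y _ = ⊥-elim (x≢y refl)

module Corona (H : Graph) (t : ℕ) where

  centre : V (Cor t H) → V H
  centre (inj₁ a)       = a
  centre (inj₂ (a , _)) = a

  pendantPart : V (Cor t H) → List (V (Cor t H))
  pendantPart (inj₁ _) = []
  pendantPart (inj₂ x) = inj₂ x ∷ []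

  lift : List (V H) → List (V (Cor t H))
  lift = map inj₁

  pendantPart-walkˡ : ∀ u {w q} → Walk (Cor t H) (inj₁ (centre u)) w q →
                      Walk (Cor t H) u w (pendantPart u ++ q)
  pendantPart-walkˡ (inj₁ _) wk = wk
  pendantPart-walkˡ (inj₂ _) wk = step refl wk

  pendantPart-walkʳ : ∀ v {w q} → Walk (Cor t H) w (inj₁ (centre v)) q →
                      Walk (Cor t H) w v (q ++ pendantPart v)
  pendantPart-walkʳ (inj₁ _) {q = q} wk rewrite ++-identityʳ q = wk
  pendantPart-walkʳ (inj₂ _) wk = walk-join wk refl (single _)

  ∈-pendantPart : ∀ {x} v → x ∈ pendantPart v → centre x ≡ centre v
  ∈-pendantPart (inj₂ _) (here refl) = refl

  pendant∉lift : ∀ {x p} → inj₂ x ∉ lift p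
  pendant∉lift x∈ with ∈-map⁻ inj₁ x∈
  ... | _ , _ , ()

  lift-unique : ∀ {p} → Unique p → Unique (lift p)
  lift-unique = Unique.map⁺ λ { refl → refl }

  pendantPart-uniqueʳ : ∀ v {p} → Unique (lift p) → Unique (lift p ++ pendantPart v)
  pendantPart-uniqueʳ (inj₁ _) {p} u rewrite ++-identityʳ (lift p) = u
  pendantPart-uniqueʳ (inj₂ _) u = Unique.++⁺ u ([] ∷ []) λ { (x∈p , here refl) → pendant∉lift x∈p }

  pendantPart-uniqueˡ : ∀ u v {p} → centre u ≢ centre v → Unique (lift p ++ pendantPart v) →
                        Unique (pendantPart u ++ lift p ++ pendantPart v)
  pendantPart-uniqueˡ (inj₁ _) v u≢v uniq = uniq
  pendantPart-uniqueˡ (inj₂ _) v {p} u≢v uniq = ¬Any⇒All¬ _ u∉ ∷ uniq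
    where
    u∉ : inj₂ _ ∉ lift p ++ pendantPart v
    u∉ u∈ with ∈-++⁻ (lift p) u∈
    ... | inj₁ u∈p = pendant∉lift u∈p
    ... | inj₂ u∈v = u≢v (∈-pendantPart v u∈v)

  corona-path : ∀ (u v : V (Cor t H)) {p} → centre u ≢ centre v → IsPath H (centre u) (centre v) p →
                IsPath (Cor t H) u v (pendantPart u ++ lift p ++ pendantPart v)
  corona-path u v u≢v (wk , uniq) =
    pendantPart-walkˡ u (pendantPart-walkʳ v (walk-map inj₁ (λ a → a) wk)) ,
    pendantPart-uniqueˡ u v u≢v (pendantPart-uniqueʳ v (lift-unique uniq))

  pendant-neighbour : ∀ {a i w} → Adj (Cor t H) (inj₂ (a , i)) w → w ≡ inj₁ a
  pendant-neighbour {w = inj₁ _} refl = refl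

  centre-before-pendant : ∀ {u w b j q} → Adj (Cor t H) u w → Walk (Cor t H) w (inj₂ (b , j)) q →
                          inj₁ b ∈ u ∷ q
  centre-before-pendant {u = inj₁ _} refl (single _)   = here refl
  centre-before-pendant {u = inj₂ _} ()   (single _)
  centre-before-pendant _            (step adj wk) = there (centre-before-pendant adj wk)

  pendant-to-centre : ∀ {a i p} → IsPath (Cor t H) (inj₂ (a , i)) (inj₁ a) p →
                      p ≡ inj₂ (a , i) ∷ inj₁ a ∷ []
  pendant-to-centre (step {w = inj₁ _} refl (single _) , _) = refl
  pendant-to-centre (step {w = inj₁ _} refl (step _ wk) , _ ∷ (a∉ ∷ _)) =
    ⊥-elim (All.lookup a∉ (walk-last wk) refl)

  pendant-coloured-as-centre : ∀ {k} (c : V (Cor t H) → Fin k) {a i} → c (inj₂ (a , i)) ≡ c (inj₁ a) →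
                               ¬ CFVConnected (Cor t H) c
  pendant-coloured-as-centre c {a} {i} same cf with cf (inj₂ (a , i)) (inj₁ a)
  ... | p , path , _ , count≡1 rewrite pendant-to-centre path = countColour-pair≢1 c same count≡1

  corona-not-2-colourable : ∀ {a b : V H} → a ≢ b → Fin t → (c : V (Cor t H) → Fin 2) →
                            ¬ CFVConnected (Cor t H) c
  corona-not-2-colourable {a} {b} a≢b i c cf
    with c (inj₂ (a , i)) ≟ c (inj₁ a) | c (inj₂ (b , i)) ≟ c (inj₁ b)
  ... | yes same | _        = pendant-coloured-as-centre c same cf
  ... | no _     | yes same = pendant-coloured-as-centre c same cf
  ... | no a-split | no b-split with cf (inj₂ (a , i)) (inj₂ (b , i))
  ... | _ , (single _ , _) , _ = ⊥-elim (a≢b refl)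
  ... | p , (wk@(step adj wk′) , _) , col , count≡1 =
    <-irrefl (sym count≡1) (twice (Fin2-cover a-split col) (Fin2-cover b-split col))
    where
    pa∈ : inj₂ (a , i) ∈ p
    pa∈ = walk-head wk
    a∈ : inj₁ a ∈ p
    a∈ = there (subst (_∈ _) (pendant-neighbour adj) (walk-head wk′))
    b∈ : inj₁ b ∈ p
    b∈ = centre-before-pendant adj wk′
    pb∈ : inj₂ (b , i) ∈ p
    pb∈ = walk-last wk
    twice : c (inj₂ (a , i)) ≡ col ⊎ c (inj₁ a) ≡ col → c (inj₂ (b , i)) ≡ col ⊎ c (inj₁ b) ≡ col →
            2 ≤ countColour c col p
    twice (inj₁ ca) (inj₁ cb) = countColour-≥2 c pa∈ pb∈ (λ { refl → a≢b refl }) ca cb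
    twice (inj₁ ca) (inj₂ cb) = countColour-≥2 c pa∈ b∈ (λ ()) ca cb
    twice (inj₂ ca) (inj₁ cb) = countColour-≥2 c a∈ pb∈ (λ ()) ca cb
    twice (inj₂ ca) (inj₂ cb) = countColour-≥2 c a∈ b∈ (λ { refl → a≢b refl }) ca cb

  corona-needs-3-colours : ∀ {a b : V H} → a ≢ b → Fin t → ∀ k → k < 3 → (c : V (Cor t H) → Fin k) →
                           ¬ CFVConnected (Cor t H) c
  corona-needs-3-colours {a} _ _ 0 _ c _ with c (inj₁ a)
  ... | ()
  corona-needs-3-colours {a} _ i 1 _ c = pendant-coloured-as-centre c {a} {i} (Fin1-unique _ _)
  corona-needs-3-colours a≢b i 2 _ c = corona-not-2-colourable a≢b i c
  corona-needs-3-colours _ _ (suc (suc (suc _))) (s≤s (s≤s (s≤s ())))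

module HubColouring (H : Graph) (t : ℕ) (_≟ᴴ_ : DecidableEquality (V H)) (hub : V H) where

  open Corona H t

  otherColour pendantColour hubColour : Fin 3
  otherColour   = Fin.zero
  pendantColour = Fin.suc Fin.zero
  hubColour     = Fin.suc (Fin.suc Fin.zero)

  hubColouring : V (Cor t H) → Fin 3
  hubColouring (inj₁ a) with a ≟ᴴ hub
  ... | yes _ = hubColour
  ... | no _  = otherColour
  hubColouring (inj₂ _) = pendantColour

  hubColouring-hub : hubColouring (inj₁ hub) ≡ hubColour
  hubColouring-hub with hub ≟ᴴ hub
  ... | yes _     = refl
  ... | no hub≢hub = ⊥-elim (hub≢hub refl)

  hubColouring≡hubColour : ∀ x → hubColouring x ≡ hubColour → x ≡ inj₁ hub
  hubColouring≡hubColour (inj₁ a) c≡ with a ≟ᴴ hub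
  hubColouring≡hubColour (inj₁ a) refl | yes refl = refl
  hubColouring≡hubColour (inj₁ a) ()   | no _
  hubColouring≡hubColour (inj₂ _) ()

  hubColouring-core≢pendantColour : ∀ a → hubColouring (inj₁ a) ≢ pendantColour
  hubColouring-core≢pendantColour a with a ≟ᴴ hub
  ... | yes _ = λ ()
  ... | no _  = λ ()

  CFPath : V (Cor t H) → V (Cor t H) → Set
  CFPath u v = ∃[ p ] (IsPath (Cor t H) u v p × ConflictFree hubColouring p)

  trivial-cf : ∀ u → CFPath u u
  trivial-cf u =
    u ∷ [] , (single u , [] ∷ []) ,
    conflictFree-by hubColouring u ([] ∷ []) (here refl) refl ((λ _ → refl) ∷ [])

  same-centre-cf : ∀ u v → centre u ≡ centre v → CFPath u v
  same-centre-cf (inj₁ a) (inj₁ _) refl = trivial-cf (inj₁ a)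
  same-centre-cf (inj₁ a) (inj₂ (_ , i)) refl =
    _ , (step refl (single _) , ((λ ()) ∷ []) ∷ [] ∷ []) ,
    conflictFree-by hubColouring (inj₂ (a , i)) (((λ ()) ∷ []) ∷ [] ∷ []) (there (here refl)) refl
      ((λ c≡ → ⊥-elim (hubColouring-core≢pendantColour a c≡)) ∷ (λ _ → refl) ∷ [])
  same-centre-cf (inj₂ (a , i)) (inj₁ _) refl =
    _ , (step refl (single _) , ((λ ()) ∷ []) ∷ [] ∷ []) ,
    conflictFree-by hubColouring (inj₂ (a , i)) (((λ ()) ∷ []) ∷ [] ∷ []) (here refl) refl
      ((λ _ → refl) ∷ (λ c≡ → ⊥-elim (hubColouring-core≢pendantColour a c≡)) ∷ [])
  same-centre-cf (inj₂ (a , i)) (inj₂ (_ , j)) refl with i ≟ j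
  ... | yes refl = trivial-cf (inj₂ (a , i))
  ... | no i≢j =
    _ , (step refl (step refl (single _)) , uniq) ,
    conflictFree-by hubColouring (inj₁ a) uniq (there (here refl)) refl
      ((λ c≡ → ⊥-elim (hubColouring-core≢pendantColour a (sym c≡))) ∷ (λ _ → refl) ∷
       (λ c≡ → ⊥-elim (hubColouring-core≢pendantColour a (sym c≡))) ∷ [])
    where
    uniq : Unique (inj₂ (a , i) ∷ inj₁ a ∷ inj₂ (a , j) ∷ [])
    uniq = ((λ ()) ∷ (λ { refl → i≢j refl }) ∷ []) ∷ ((λ ()) ∷ []) ∷ [] ∷ []

  hubColouring-cfConnected : (∀ a b → a ≢ b → ∃[ p ] (IsPath H a b p × hub ∈ p)) →
                             CFVConnected (Cor t H) hubColouring
  hubColouring-cfConnected through-hub u v with centre u ≟ᴴ centre v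
  ... | yes u≡v = same-centre-cf u v u≡v
  ... | no u≢v =
    let p , path , hub∈p = through-hub (centre u) (centre v) u≢v
        walk , uniq = corona-path u v u≢v path
    in _ , (walk , uniq) ,
       conflictFree-by hubColouring (inj₁ hub) uniq
         (∈-++⁺ʳ (pendantPart u) (∈-++⁺ˡ (∈-map⁺ inj₁ hub∈p))) hubColouring-hub
         (All.tabulate λ {x} _ → hubColouring≡hubColour x)

proposition1 : (n t : ℕ) → 3 ≤ n → 1 ≤ t → vcfc≡ (Cor t (Cycle n)) 3
proposition1 (suc (suc (suc m))) (suc t) _ _ =
  (hubColouring , hubColouring-cfConnected cycle-through-zero) ,
  Corona.corona-needs-3-colours (Cycle n) (suc t) {Fin.zero} {Fin.suc Fin.zero} (λ ()) Fin.zero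
  where
  n = suc (suc (suc m))
  open HubColouring (Cycle n) (suc t) _≟_ Fin.zero
proposition1 1 _ (s≤s ()) _
proposition1 2 _ (s≤s (s≤s ())) _
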